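{- Let $m\ge2$, $g\ge0$, $n=m+g(m-1)$, and let $t$ be an $m$-ary tree with $n$ leaves and depth $(\delta^{l_1}(t),\dots,\delta^{l_m}(t))$. Then $\delta^{l_{m-1}}_{n-1}(t)=1$, and $\delta^{l_i}_{n-1}(t)=0$ for $1\le i\le m-2$.
   Context: An $m$-ary tree is a rooted tree in which each node has either $0$ or $m$ linearly ordered children; nodes without children are leaves, numbered $1,\dots,n$ from left to right. Each edge joining a node to its $i$-th child is labelled $l_i$. For $1\le i\le m$ and $1\le j\le n$, $\delta^{l_i}_j(t)$ is the number of edges labelled $l_i$ on the unique path from the root to the $j$-th leaf; $\delta^{l_i}(t)=(\delta^{l_i}_1(t),\dots,\delta^{l_i}_n(t))$, and the depth of $t$ is $(\delta^{l_1}(t),\dots,\delta^{l_m}(t))$. -}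

module Defs where

open import Data.Nat using (ℕ; zero; suc; _+_; _≟_)
open import Data.Fin using (Fin; toℕ)
open import Data.List using (List; []; _∷_; [_]; map; concat; length; filter; allFin)
open import Data.Maybe using (Maybe; just; nothing; maybe)

-- An m-ary tree: each node is a leaf or has exactly m linearly ordered
-- children (the i-th child, 0-based index i : Fin m, is reached by the
-- edge labelled l_{i+1}).
data Tree (m : ℕ) : Set where
  leaf : Tree m
  node : (Fin m → Tree m) → Tree m

paths : ∀ {m} → Tree m → List (List (Fin m))
paths leaf     = [ [] ]
paths {m} (node f) = concat (map (λ i → map (i ∷_) (paths (f i))) (allFin m))

numLeaves : ∀ {m} → Tree m → ℕ
numLeaves t = length (paths t)

nth : ∀ {A : Set} → List A → ℕ → Maybe A
nth []       _       = nothing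
nth (x ∷ xs) zero    = just x
nth (x ∷ xs) (suc k) = nth xs k

countLabel : ∀ {m} → ℕ → List (Fin m) → ℕ
countLabel i p = length (filter (λ x → suc (toℕ x) ≟ i) p)

-- δ t i j = δ^{l_i}_j(t), with i and j 1-based as in the paper
-- (value 0 for j out of range 1..n, a case never used in the statement).
δ : ∀ {m} → Tree m → ℕ → ℕ → ℕ
δ t i zero    = 0
δ t i (suc j) = maybe (countLabel i) 0 (nth (paths t) j)

-- Going down from the root along last edges (label l_m) reaches a node whose last
-- child is a leaf; leaf n is that leaf, and leaf n - 1 is the rightmost leaf of the
-- sibling just before it. So the path to leaf n - 1 reads l_m^a l_{m-1} l_m^b, one
-- edge labelled l_{m-1} and none labelled l_1, ..., l_{m-2}. The leaf count only
-- matters through n ≥ 2, which rules out the one-leaf tree.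
module Submission where

open import Defs
open import Data.Nat using (ℕ; suc; _+_; _*_; _∸_; _≤_; _≟_; s≤s; z≤n)
open import Data.Nat.Properties using (+-comm; >⇒≢; m≤n⇒m≤1+n; n<1+n)
open import Data.Fin using (Fin; toℕ; fromℕ; inject₁)
open import Data.Fin.Properties using (toℕ-fromℕ; toℕ-inject₁)
open import Data.List using (List; []; _∷_; [_]; _++_; map; concat; length; filter; tabulate)
open import Data.List.Properties
  using (++-assoc; ++-identityʳ; map-++; map-tabulate; length-++; filter-++; filter-accept; filter-reject)
open import Data.List.Relation.Unary.All using (All; []; _∷_)
open import Data.Maybe using (just; maybe)
open import Relation.Nullary using (Dec)
open import Data.Product using (_×_; _,_; ∃-syntax)
open import Function using (_∘_; id)
open import Relation.Binary.PropositionalEquality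
  using (_≡_; _≢_; refl; sym; trans; cong; cong₂; module ≡-Reasoning)

open ≡-Reasoning

private variable
  A : Set
  m : ℕ

concat-tabulate-suc : (h : Fin (suc m) → List A) →
  concat (tabulate h) ≡ concat (tabulate (h ∘ inject₁)) ++ h (fromℕ m)
concat-tabulate-suc {ℕ.zero} h = ++-identityʳ (h Fin.zero)
concat-tabulate-suc {suc m} h = begin
  h Fin.zero ++ concat (tabulate (h ∘ Fin.suc))
    ≡⟨ cong (h Fin.zero ++_) (concat-tabulate-suc (h ∘ Fin.suc)) ⟩
  h Fin.zero ++ (concat (tabulate (h ∘ Fin.suc ∘ inject₁)) ++ h (fromℕ (suc m)))
    ≡⟨ ++-assoc (h Fin.zero) _ _ ⟨
  concat (tabulate (h ∘ inject₁)) ++ h (fromℕ (suc m)) ∎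

++-map-++ : ∀ {B : Set} (zs : List B) (f : A → B) xs ys →
  zs ++ map f (xs ++ ys) ≡ (zs ++ map f xs) ++ map f ys
++-map-++ zs f xs ys = trans (cong (zs ++_) (map-++ f xs ys)) (sym (++-assoc zs (map f xs) (map f ys)))

nth-++-length : (xs : List A) {y : A} {ys : List A} → nth (xs ++ y ∷ ys) (length xs) ≡ just y
nth-++-length []       = refl
nth-++-length (x ∷ xs) = nth-++-length xs

hasLabel? : ∀ i (x : Fin m) → Dec (suc (toℕ x) ≡ i)
hasLabel? i x = suc (toℕ x) ≟ i

countLabel-∷-≡ : ∀ {i} (x : Fin m) p → suc (toℕ x) ≡ i → countLabel i (x ∷ p) ≡ suc (countLabel i p)
countLabel-∷-≡ {i = i} x p e = cong length (filter-accept (hasLabel? i) e)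

countLabel-∷-≢ : ∀ {i} (x : Fin m) p → suc (toℕ x) ≢ i → countLabel i (x ∷ p) ≡ countLabel i p
countLabel-∷-≢ {i = i} x p ne = cong length (filter-reject (hasLabel? i) ne)

countLabel-++ : ∀ i (p q : List (Fin m)) → countLabel i (p ++ q) ≡ countLabel i p + countLabel i q
countLabel-++ i p q = trans (cong length (filter-++ (hasLabel? i) p q)) (length-++ (filter (hasLabel? i) p))

lastChild : Fin (suc m)
lastChild {m} = fromℕ m

countLabel-rightmost : ∀ {i} {q : List (Fin (suc m))} → All (_≡ lastChild) q → suc m ≢ i →
  countLabel i q ≡ 0
countLabel-rightmost []                 ne = refl
countLabel-rightmost {m} (refl ∷ q-last) ne =
  trans (countLabel-∷-≢ lastChild _ (ne ∘ trans (cong suc (sym (toℕ-fromℕ m)))))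
        (countLabel-rightmost q-last ne)

countLabel-++-rightmost : ∀ {i} {r s : List (Fin (suc m))} (p : List (Fin (suc m))) →
  All (_≡ lastChild) r → All (_≡ lastChild) s → suc m ≢ i → countLabel i (r ++ p ++ s) ≡ countLabel i p
countLabel-++-rightmost {i = i} {r} {s} p r-last s-last ne = begin
  countLabel i (r ++ p ++ s)                       ≡⟨ countLabel-++ i r (p ++ s) ⟩
  countLabel i r + countLabel i (p ++ s)           ≡⟨ cong (_+ countLabel i (p ++ s)) (countLabel-rightmost r-last ne) ⟩
  countLabel i (p ++ s)                            ≡⟨ countLabel-++ i p s ⟩
  countLabel i p + countLabel i s                  ≡⟨ cong (countLabel i p +_) (countLabel-rightmost s-last ne) ⟩
  countLabel i p + 0                               ≡⟨ +-comm (countLabel i p) 0 ⟩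
  countLabel i p                                   ∎

childPaths : (Fin m → Tree m) → Fin m → List (List (Fin m))
childPaths f i = map (i ∷_) (paths (f i))

paths-node-∷ʳ : (f : Fin (suc m) → Tree (suc m)) →
  paths (node f) ≡ concat (tabulate (childPaths f ∘ inject₁)) ++ childPaths f lastChild
paths-node-∷ʳ f = trans (cong concat (map-tabulate id (childPaths f))) (concat-tabulate-suc (childPaths f))

paths-last : (t : Tree (suc m)) → ∃[ xs ] ∃[ q ] (paths t ≡ xs ++ [ q ] × All (_≡ lastChild) q)
paths-last leaf = [] , [] , refl , []
paths-last {m} (node f) with paths-last (f lastChild)
... | xs , q , e , q-last =
  C ++ map (lastChild ∷_) xs , lastChild ∷ q ,
  trans (paths-node-∷ʳ f) (trans (cong (λ L → C ++ map (lastChild ∷_) L) e) (++-map-++ C (lastChild ∷_) xs [ q ])) ,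
  refl ∷ q-last
  where
  C : List (List (Fin (suc m)))
  C = concat (tabulate (childPaths f ∘ inject₁))

module _ {k : ℕ} where

  secondLastChild : Fin (suc (suc k))
  secondLastChild = inject₁ lastChild

  paths-penultimate : (f : Fin (suc (suc k)) → Tree (suc (suc k))) →
    ∃[ xs ] ∃[ r ] ∃[ s ] ∃[ q ]
      (paths (node f) ≡ xs ++ (r ++ secondLastChild ∷ s) ∷ q ∷ []
       × All (_≡ lastChild) r × All (_≡ lastChild) s)
  paths-penultimate f with f lastChild in f-last | paths-last (f secondLastChild)
  ... | leaf | ys , s , e , s-last =
    C ++ map (secondLastChild ∷_) ys , [] , s , lastChild ∷ [] , paths≡ , [] , s-last
    where
    C : List (List (Fin (suc (suc k))))
    C = concat (tabulate (childPaths f ∘ inject₁ ∘ inject₁))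

    paths≡ : paths (node f) ≡ (C ++ map (secondLastChild ∷_) ys) ++ (secondLastChild ∷ s) ∷ [ lastChild ] ∷ []
    paths≡ = begin
      paths (node f)
        ≡⟨ paths-node-∷ʳ f ⟩
      concat (tabulate (childPaths f ∘ inject₁)) ++ map (lastChild ∷_) (paths (f lastChild))
        ≡⟨ cong₂ _++_ (concat-tabulate-suc (childPaths f ∘ inject₁))
                      (cong (map (lastChild ∷_) ∘ paths) f-last) ⟩
      (C ++ map (secondLastChild ∷_) (paths (f secondLastChild))) ++ [ [ lastChild ] ]
        ≡⟨ cong (λ L → (C ++ map (secondLastChild ∷_) L) ++ [ [ lastChild ] ]) e ⟩
      (C ++ map (secondLastChild ∷_) (ys ++ [ s ])) ++ [ [ lastChild ] ]
        ≡⟨ cong (_++ [ [ lastChild ] ]) (++-map-++ C (secondLastChild ∷_) ys [ s ]) ⟩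
      ((C ++ map (secondLastChild ∷_) ys) ++ [ secondLastChild ∷ s ]) ++ [ [ lastChild ] ]
        ≡⟨ ++-assoc (C ++ map (secondLastChild ∷_) ys) _ _ ⟩
      (C ++ map (secondLastChild ∷_) ys) ++ (secondLastChild ∷ s) ∷ [ lastChild ] ∷ [] ∎
  ... | node g | _ with paths-penultimate g
  ...   | xs , r , s , q , e , r-last , s-last =
    C ++ map (lastChild ∷_) xs , lastChild ∷ r , s , lastChild ∷ q ,
    trans (paths-node-∷ʳ f)
          (trans (cong (λ t → C ++ map (lastChild ∷_) (paths t)) f-last)
                 (trans (cong (λ L → C ++ map (lastChild ∷_) L) e) (++-map-++ C (lastChild ∷_) xs _))) ,
    refl ∷ r-last , s-last
    where
    C : List (List (Fin (suc (suc k))))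
    C = concat (tabulate (childPaths f ∘ inject₁))

δ-penultimate : ∀ {t : Tree m} {xs p q} → paths t ≡ xs ++ p ∷ q ∷ [] →
  ∀ i → δ t i (numLeaves t ∸ 1) ≡ countLabel i p
δ-penultimate {t = t} {xs} {p} e i = begin
  δ t i (length (paths t) ∸ 1)
    ≡⟨ cong (λ n → δ t i (n ∸ 1)) (trans (cong length e) (trans (length-++ xs) (+-comm (length xs) 2))) ⟩
  maybe (countLabel i) 0 (nth (paths t) (length xs))
    ≡⟨ cong (maybe (countLabel i) 0) (trans (cong (λ L → nth L (length xs)) e) (nth-++-length xs)) ⟩
  countLabel i p ∎

lemma2p15 : (m g : ℕ) → 2 ≤ m → (t : Tree m) → numLeaves t ≡ m + g * (m ∸ 1) →
    (δ t (m ∸ 1) ((m + g * (m ∸ 1)) ∸ 1) ≡ 1)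
    × ((i : ℕ) → 1 ≤ i → i ≤ m ∸ 2 → δ t i ((m + g * (m ∸ 1)) ∸ 1) ≡ 0)
lemma2p15 (suc (suc k)) g (s≤s (s≤s z≤n)) leaf ()
lemma2p15 (suc (suc k)) g (s≤s (s≤s z≤n)) (node f) n≡ with paths-penultimate f
... | _ , r , s , _ , e , r-last , s-last = label-m-1 , other-labels
  where
  secondLastChild-label : suc (toℕ (secondLastChild {k})) ≡ suc k
  secondLastChild-label = cong suc (trans (toℕ-inject₁ lastChild) (toℕ-fromℕ k))

  δ-at : ∀ i → suc (suc k) ≢ i → δ (node f) i ((suc (suc k) + g * suc k) ∸ 1) ≡ countLabel i [ secondLastChild ]
  δ-at i ne = begin
    δ (node f) i ((suc (suc k) + g * suc k) ∸ 1)  ≡⟨ cong (λ n → δ (node f) i (n ∸ 1)) n≡ ⟨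
    δ (node f) i (numLeaves (node f) ∸ 1)         ≡⟨ δ-penultimate {t = node f} e i ⟩
    countLabel i (r ++ [ secondLastChild ] ++ s)  ≡⟨ countLabel-++-rightmost [ secondLastChild {k} ] r-last s-last ne ⟩
    countLabel i [ secondLastChild {k} ]          ∎

  label-m-1 : δ (node f) (suc k) ((suc (suc k) + g * suc k) ∸ 1) ≡ 1
  label-m-1 = trans (δ-at (suc k) (>⇒≢ (n<1+n (suc k))))
                    (countLabel-∷-≡ secondLastChild [] secondLastChild-label)

  other-labels : ∀ i → 1 ≤ i → i ≤ k → δ (node f) i ((suc (suc k) + g * suc k) ∸ 1) ≡ 0
  other-labels i _ i≤k = trans (δ-at i (>⇒≢ (m≤n⇒m≤1+n (s≤s i≤k))))
    (countLabel-∷-≢ secondLastChild [] (>⇒≢ (s≤s i≤k) ∘ trans (sym secondLastChild-label)))
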